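{- Let $K$ be a Kleene algebra, $D$ a bounded distributive lattice, and $\varphi: K\to D$ a $(0,1)$-lattice homomorphism such that $\varphi(K^{\wedge})=\{0_D\}$, where $K^{\wedge}=\{x\wedge x^{\circ}\mid x\in K\}$. Let $$L=\{(x,y)\mid x\in K,\ y\in D,\ y\le \varphi(x)\}$$ with operations $(x_1,y_1)\vee(x_2,y_2)=(x_1\vee x_2,y_1\vee y_2)$, $(x_1,y_1)\wedge(x_2,y_2)=(x_1\wedge x_2,y_1\wedge y_2)$, $(x,y)^{\circ}=(x^{\circ},\varphi(x^{\circ}))$, $0_L=(0,0)$, $1_L=(1,1)$. Put $L^{\vee}=\{u\vee u^{\circ}\mid u\in L\}$, $L^{\wedge}=\{u\wedge u^{\circ}\mid u\in L\}$ and $K^{\vee}=\{x\vee x^{\circ}\mid x\in K\}$. Then $$L^{\vee}=\{(x,y)\in L\mid x\in K^{\vee}\},\qquad L^{\wedge}=\{(x,y)\in L\mid x\in K^{\wedge}\}.$$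
   Context: An MS-algebra is an algebra $(L;\vee,\wedge,{}^{\circ},0,1)$ where $(L;\vee,\wedge,0,1)$ is a bounded distributive lattice and ${}^{\circ}$ is a unary operation with $x\le x^{\circ\circ}$, $(x\wedge y)^{\circ}=x^{\circ}\vee y^{\circ}$ and $1^{\circ}=0$. A de Morgan algebra is an MS-algebra satisfying $x=x^{\circ\circ}$; a Kleene algebra is a de Morgan algebra satisfying $(x\wedge x^{\circ})\vee y\vee y^{\circ}=y\vee y^{\circ}$. (The set $L$ above is an MS-algebra under the given operations.) -}

module Defs where

open import Level using (Level; suc; _⊔_)
open import Data.Product using (Σ; ∃; _×_; _,_; proj₁; proj₂)
open import Relation.Binary.PropositionalEquality using (_≡_)
open import Algebra.Lattice.Structures using (IsDistributiveLattice)

record BDLattice (c : Level) : Set (suc c) where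
  infixr 6 _∨_
  infixr 7 _∧_
  field
    Carrier : Set c
    _∨_ _∧_ : Carrier → Carrier → Carrier
    𝟘 𝟙 : Carrier
    isDistributiveLattice : IsDistributiveLattice {A = Carrier} _≡_ _∨_ _∧_
    ∨-identityʳ : ∀ x → x ∨ 𝟘 ≡ x
    ∧-identityʳ : ∀ x → x ∧ 𝟙 ≡ x

  _≤_ : Carrier → Carrier → Set c
  x ≤ y = x ∧ y ≡ x

record MSAlgebra (c : Level) : Set (suc c) where
  field
    lattice : BDLattice c
  open BDLattice lattice public
  field
    _° : Carrier → Carrier
    ≤-°° : ∀ x → x ≤ ((x °) °)
    °-∧ : ∀ x y → (x ∧ y) ° ≡ (x °) ∨ (y °)
    𝟙° : 𝟙 ° ≡ 𝟘

record KleeneAlgebra (c : Level) : Set (suc c) where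
  field
    msAlgebra : MSAlgebra c
  open MSAlgebra msAlgebra public
  field
    °° : ∀ x → (x °) ° ≡ x
    kleene : ∀ x y → ((x ∧ (x °)) ∨ y ∨ (y °)) ≡ (y ∨ (y °))

record Is01Hom {c d : Level} (K : BDLattice c) (D : BDLattice d)
               (φ : BDLattice.Carrier K → BDLattice.Carrier D) : Set (c ⊔ d) where
  private
    module K = BDLattice K
    module D = BDLattice D
  field
    pres-∨ : ∀ x y → φ (x K.∨ y) ≡ φ x D.∨ φ y
    pres-∧ : ∀ x y → φ (x K.∧ y) ≡ φ x D.∧ φ y
    pres-𝟘 : φ K.𝟘 ≡ D.𝟘
    pres-𝟙 : φ K.𝟙 ≡ D.𝟙

module Construction {c d : Level} (K : KleeneAlgebra c) (D : BDLattice d)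
                    (φ : KleeneAlgebra.Carrier K → BDLattice.Carrier D) where
  private
    module K = KleeneAlgebra K
    module D = BDLattice D

  P : Set (c ⊔ d)
  P = K.Carrier × D.Carrier

  InL : P → Set d
  InL (x , y) = y D.≤ φ x

  _∨L_ : P → P → P
  (x₁ , y₁) ∨L (x₂ , y₂) = (x₁ K.∨ x₂ , y₁ D.∨ y₂)

  _∧L_ : P → P → P
  (x₁ , y₁) ∧L (x₂ , y₂) = (x₁ K.∧ x₂ , y₁ D.∧ y₂)

  _°L : P → P
  (x , y) °L = ((x K.°) , φ (x K.°))

  InK∨ : K.Carrier → Set c
  InK∨ x = ∃ λ z → x ≡ z K.∨ (z K.°)

  InK∧ : K.Carrier → Set c
  InK∧ x = ∃ λ z → x ≡ z K.∧ (z K.°)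

  InL∨ : P → Set (c ⊔ d)
  InL∨ p = Σ P λ u → InL u × (p ≡ u ∨L (u °L))

  InL∧ : P → Set (c ⊔ d)
  InL∧ p = Σ P λ u → InL u × (p ≡ u ∧L (u °L))

module Submission where

-- The inclusions  L^∨ ⊆ {(x , y) ∈ L | x ∈ K^∨}  and  L^∧ ⊆ {… | x ∈ K^∧}
-- hold because L is closed under ∨, ∧ and ° (φ is a lattice homomorphism),
-- and the first coordinate of u ∨ u° (resp. u ∧ u°) is x ∨ x° (resp. x ∧ x°).
-- For the converse inclusions every suitable element is its own witness:
--   * if a = z ∨ z° then a° = z° ∧ z°° ∈ K^∧, so φ(a°) = 0, and the Kleene
--     identity gives a ∨ a° = a; hence (a , b) = (a , b) ∨ (a , b)°;
--   * if a = z ∧ z° then b ≤ φ a = 0 forces b = 0, and a ∧ a° = a holds in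
--     every MS-algebra; hence (a , 0) = (a , 0) ∧ (a , 0)°.

open import Defs
open import Level using (Level)
open import Data.Product using (_×_; proj₁; _,_)
open import Relation.Binary.PropositionalEquality
  using (_≡_; refl; sym; trans; cong; cong₂; module ≡-Reasoning)
open import Function.Bundles using (_⇔_; mk⇔)
open import Algebra.Lattice.Bundles using (Lattice)
open import Algebra.Lattice.Structures using (module IsDistributiveLattice)
import Algebra.Lattice.Properties.Lattice as LatticeProperties
import Relation.Binary.Lattice as OrderLattice
import Relation.Binary.Lattice.Properties.JoinSemilattice as JoinProperties
import Relation.Binary.Lattice.Properties.MeetSemilattice as MeetProperties

module LatticeOrder {d} (D : BDLattice d) where
  open BDLattice D
  open IsDistributiveLattice isDistributiveLattice
    using (isLattice; ∨-comm; ∧-comm; ∧-absorbs-∨)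

  private
    algebraicLattice : Lattice d d
    algebraicLattice = record { isLattice = isLattice }

    -- The library's order-theoretic lattice uses  x ≈ x ∧ y  as its order,
    -- which is the symmetric form of  _≤_.
    orderLattice : OrderLattice.Lattice d d d
    orderLattice = LatticeProperties.∨-∧-orderTheoreticLattice algebraicLattice
    open OrderLattice.Lattice orderLattice using (joinSemilattice; meetSemilattice)

  ≤-refl : ∀ x → x ≤ x
  ≤-refl = LatticeProperties.∧-idem algebraicLattice

  ∨-mono : ∀ {x y u v} → x ≤ y → u ≤ v → (x ∨ u) ≤ (y ∨ v)
  ∨-mono x≤y u≤v = sym (JoinProperties.∨-monotonic joinSemilattice (sym x≤y) (sym u≤v))

  ∧-mono : ∀ {x y u v} → x ≤ y → u ≤ v → (x ∧ u) ≤ (y ∧ v)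
  ∧-mono x≤y u≤v = sym (MeetProperties.∧-monotonic meetSemilattice (sym x≤y) (sym u≤v))

  𝟘-least : ∀ x → 𝟘 ≤ x
  𝟘-least x = begin
    𝟘 ∧ x        ≡⟨ cong (𝟘 ∧_) (sym (trans (∨-comm 𝟘 x) (∨-identityʳ x))) ⟩
    𝟘 ∧ (𝟘 ∨ x)  ≡⟨ ∧-absorbs-∨ 𝟘 x ⟩
    𝟘            ∎
    where open ≡-Reasoning

  ≤𝟘⇒≡𝟘 : ∀ {x} → x ≤ 𝟘 → x ≡ 𝟘
  ≤𝟘⇒≡𝟘 {x} x≤𝟘 = trans (sym x≤𝟘) (trans (∧-comm x 𝟘) (𝟘-least x))

module MSProperties {c} (M : MSAlgebra c) where
  open MSAlgebra M
  open IsDistributiveLattice isDistributiveLattice using (∧-assoc; ∧-absorbs-∨)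
  open ≡-Reasoning

  K∧-∧-°-fixed : ∀ z → (z ∧ (z °)) ∧ ((z ∧ (z °)) °) ≡ z ∧ (z °)
  K∧-∧-°-fixed z = begin
    (z ∧ (z °)) ∧ ((z ∧ (z °)) °)        ≡⟨ cong ((z ∧ (z °)) ∧_) (°-∧ z (z °)) ⟩
    (z ∧ (z °)) ∧ ((z °) ∨ ((z °) °))    ≡⟨ ∧-assoc z (z °) _ ⟩
    z ∧ ((z °) ∧ ((z °) ∨ ((z °) °)))    ≡⟨ cong (z ∧_) (∧-absorbs-∨ (z °) ((z °) °)) ⟩
    z ∧ (z °)                            ∎

module KleeneProperties {c} (K : KleeneAlgebra c) where
  open KleeneAlgebra K
  open IsDistributiveLattice isDistributiveLattice using (∨-comm)
  open ≡-Reasoning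

  °-∨ : ∀ x y → (x ∨ y) ° ≡ (x °) ∧ (y °)
  °-∨ x y = begin
    (x ∨ y) °                  ≡⟨ cong _° (sym (cong₂ _∨_ (°° x) (°° y))) ⟩
    (((x °) °) ∨ ((y °) °)) °  ≡⟨ cong _° (sym (°-∧ (x °) (y °))) ⟩
    (((x °) ∧ (y °)) °) °      ≡⟨ °° ((x °) ∧ (y °)) ⟩
    (x °) ∧ (y °)              ∎

  K∨-∨-°-fixed : ∀ z → (z ∨ (z °)) ∨ ((z ∨ (z °)) °) ≡ z ∨ (z °)
  K∨-∨-°-fixed z = begin
    (z ∨ (z °)) ∨ ((z ∨ (z °)) °)        ≡⟨ cong ((z ∨ (z °)) ∨_) (°-∨ z (z °)) ⟩
    (z ∨ (z °)) ∨ ((z °) ∧ ((z °) °))    ≡⟨ ∨-comm (z ∨ (z °)) _ ⟩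
    ((z °) ∧ ((z °) °)) ∨ z ∨ (z °)      ≡⟨ kleene (z °) z ⟩
    z ∨ (z °)                            ∎

module LProperties {c d} (K : KleeneAlgebra c) (D : BDLattice d)
    (φ : KleeneAlgebra.Carrier K → BDLattice.Carrier D)
    (hom : Is01Hom (MSAlgebra.lattice (KleeneAlgebra.msAlgebra K)) D φ) where
  private
    module K = KleeneAlgebra K
    module D = BDLattice D
  open Construction K D φ
  open Is01Hom hom
  open LatticeOrder D
  open MSProperties K.msAlgebra using (K∧-∧-°-fixed)
  open KleeneProperties K using (°-∨; K∨-∨-°-fixed)

  InL-∨L : ∀ {u v} → InL u → InL v → InL (u ∨L v)
  InL-∨L {x₁ , y₁} {x₂ , y₂} y₁≤ y₂≤ =
    trans (cong ((y₁ D.∨ y₂) D.∧_) (pres-∨ x₁ x₂)) (∨-mono y₁≤ y₂≤)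

  InL-∧L : ∀ {u v} → InL u → InL v → InL (u ∧L v)
  InL-∧L {x₁ , y₁} {x₂ , y₂} y₁≤ y₂≤ =
    trans (cong ((y₁ D.∧ y₂) D.∧_) (pres-∧ x₁ x₂)) (∧-mono y₁≤ y₂≤)

  InL-°L : ∀ u → InL (u °L)
  InL-°L (x , _) = ≤-refl (φ (x K.°))

  module _ (φ-K∧ : ∀ x → InK∧ x → φ x ≡ D.𝟘) where

    -- Every pair in K^∨ × D is fixed by u ↦ u ∨ u°, since φ kills (z ∨ z°)° ∈ K^∧.
    K∨-∨L-°L-fixed : ∀ z b →
      (z K.∨ (z K.°) , b) ∨L ((z K.∨ (z K.°) , b) °L) ≡ (z K.∨ (z K.°) , b)
    K∨-∨L-°L-fixed z b = cong₂ _,_ (K∨-∨-°-fixed z) (begin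
      b D.∨ φ ((z K.∨ (z K.°)) K.°)  ≡⟨ cong (b D.∨_) (φ-K∧ _ (z K.° , °-∨ z (z K.°))) ⟩
      b D.∨ D.𝟘                      ≡⟨ D.∨-identityʳ b ⟩
      b                              ∎)
      where open ≡-Reasoning

    InL-K∧⇒𝟘 : ∀ {z b} → InL (z K.∧ (z K.°) , b) → b ≡ D.𝟘
    InL-K∧⇒𝟘 {z} {b} b≤ = ≤𝟘⇒≡𝟘 (trans (cong (b D.∧_) (sym (φ-K∧ _ (z , refl)))) b≤)

  K∧-∧L-°L-fixed : ∀ z →
    (z K.∧ (z K.°) , D.𝟘) ∧L ((z K.∧ (z K.°) , D.𝟘) °L) ≡ (z K.∧ (z K.°) , D.𝟘)
  K∧-∧L-°L-fixed z = cong₂ _,_ (K∧-∧-°-fixed z) (𝟘-least _)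

proposition2p4 : {c d : Level} (K : KleeneAlgebra c) (D : BDLattice d)
    (φ : KleeneAlgebra.Carrier K → BDLattice.Carrier D) →
    Is01Hom (MSAlgebra.lattice (KleeneAlgebra.msAlgebra K)) D φ →
    (∀ x → Construction.InK∧ K D φ x → φ x ≡ BDLattice.𝟘 D) →
    ((p : Construction.P K D φ) →
      Construction.InL∨ K D φ p ⇔ (Construction.InL K D φ p × Construction.InK∨ K D φ (proj₁ p)))
    × ((p : Construction.P K D φ) →
      Construction.InL∧ K D φ p ⇔ (Construction.InL K D φ p × Construction.InK∧ K D φ (proj₁ p)))
proposition2p4 K D φ hom φ-K∧ = L∨-characterisation , L∧-characterisation
  where
  module D = BDLattice D
  open Construction K D φ
  open LProperties K D φ hom
  open LatticeOrder D using (𝟘-least)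

  L∨-characterisation : (p : P) → InL∨ p ⇔ (InL p × InK∨ (proj₁ p))
  L∨-characterisation (a , b) = mk⇔ ⊆-part ⊇-part
    where
    ⊆-part : InL∨ (a , b) → InL (a , b) × InK∨ a
    ⊆-part (u@(x , _) , u∈L , refl) = InL-∨L u∈L (InL-°L u) , x , refl

    ⊇-part : InL (a , b) × InK∨ a → InL∨ (a , b)
    ⊇-part (p∈L , z , refl) =
      (a , b) , p∈L , sym (K∨-∨L-°L-fixed φ-K∧ z b)

  L∧-characterisation : (p : P) → InL∧ p ⇔ (InL p × InK∧ (proj₁ p))
  L∧-characterisation (a , b) = mk⇔ ⊆-part ⊇-part
    where
    ⊆-part : InL∧ (a , b) → InL (a , b) × InK∧ a
    ⊆-part (u@(x , _) , u∈L , refl) = InL-∧L u∈L (InL-°L u) , x , refl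

    ⊇-part : InL (a , b) × InK∧ a → InL∧ (a , b)
    ⊇-part (p∈L , z , refl) =
      (a , D.𝟘) , 𝟘-least _ ,
      trans (cong (a ,_) (InL-K∧⇒𝟘 φ-K∧ p∈L)) (sym (K∧-∧L-°L-fixed z))
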